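{- Let $G$ be a connected graph and let $G'$ be the graph obtained from $G$ as follows: for each edge $e=xy$ of $G$ add a new vertex $v_e$ adjacent to $x$ and to $y$, and for every two distinct edges $e,f\in E(G)$ make $v_e$ and $v_f$ adjacent. Then $\rho^{\rm o}(G')=\rho(G)$. In addition, $G$ has a unique maximum 2-packing if and only if $G'$ has a unique maximum open packing.
   Context: An open packing in a graph is a set of vertices whose open neighborhoods are pairwise disjoint; $\rho^{\rm o}$ denotes the maximum cardinality of an open packing. A 2-packing is a set of vertices whose closed neighborhoods are pairwise disjoint (equivalently, pairwise at distance at least 3); $\rho$ denotes the maximum cardinality of a 2-packing. -}

module Defs where

open import Data.Nat using (ℕ; _≤_)
open import Data.Fin using (Fin; _<_)
open import Data.Bool using (Bool; true; false; T)
open import Data.List using (List; length)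
open import Data.List.Membership.Propositional using (_∈_)
open import Data.List.Relation.Unary.Unique.Propositional using (Unique)
open import Data.Product using (Σ; _×_; _,_; proj₁; proj₂)
open import Data.Sum using (_⊎_; inj₁; inj₂)
open import Data.Empty using (⊥)
open import Relation.Nullary using (¬_)
open import Relation.Binary.PropositionalEquality using (_≡_)
open import Function.Bundles using (_⇔_)

record SimpleGraph (n : ℕ) : Set where
  field
    adj     : Fin n → Fin n → Bool
    adj-sym : ∀ i j → adj i j ≡ adj j i
    adj-irr : ∀ i → adj i i ≡ false
open SimpleGraph public

Adj : ∀ {n} → SimpleGraph n → Fin n → Fin n → Set
Adj G i j = T (adj G i j)

data Reach {n} (G : SimpleGraph n) : Fin n → Fin n → Set where
  here : ∀ {u} → Reach G u u
  step : ∀ {u v w} → Adj G u v → Reach G v w → Reach G u w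

Connected : ∀ {n} → SimpleGraph n → Set
Connected G = ∀ u v → Reach G u v

-- Edges of G: each edge {i,j} represented once, as (i , j) with i < j.
Edge : ∀ {n} → SimpleGraph n → Set
Edge {n} G = Σ (Fin n × Fin n) λ p → (proj₁ p < proj₂ p) × Adj G (proj₁ p) (proj₂ p)

Endpoint : ∀ {n} {G : SimpleGraph n} → Fin n → Edge G → Set
Endpoint x ((i , j) , _) = (x ≡ i) ⊎ (x ≡ j)

-- The graph G' of the paper: vertices V(G) ⊎ E(G) (v_e for each edge e);
-- old edges kept, v_e adjacent to both ends of e, and v_e ~ v_f for e ≠ f.
Vtx' : ∀ {n} → SimpleGraph n → Set
Vtx' {n} G = Fin n ⊎ Edge G

Adj' : ∀ {n} (G : SimpleGraph n) → Vtx' G → Vtx' G → Set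
Adj' G (inj₁ x) (inj₁ y) = Adj G x y
Adj' G (inj₁ x) (inj₂ e) = Endpoint {G = G} x e
Adj' G (inj₂ e) (inj₁ x) = Endpoint {G = G} x e
Adj' G (inj₂ e) (inj₂ f) = ¬ (e ≡ f)

-- Generic notions for a graph given by a vertex type and adjacency relation.
-- Vertex sets are duplicate-free lists.
module _ {V : Set} (E : V → V → Set) where

  IsOpenPacking : List V → Set
  IsOpenPacking S = ∀ {u w} → u ∈ S → w ∈ S → ¬ (u ≡ w) →
                    ∀ x → E u x → E w x → ⊥

  IsTwoPacking : List V → Set
  IsTwoPacking S = ∀ {u w} → u ∈ S → w ∈ S → ¬ (u ≡ w) →
                   ∀ x → ((x ≡ u) ⊎ E u x) → ((x ≡ w) ⊎ E w x) → ⊥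

module _ {V : Set} where

  SameSet : List V → List V → Set
  SameSet S T = ∀ x → (x ∈ S) ⇔ (x ∈ T)

  IsMaximum : (List V → Set) → List V → Set
  IsMaximum P S = Unique S × P S × (∀ T → Unique T → P T → length T ≤ length S)

  IsMaxCard : (List V → Set) → ℕ → Set
  IsMaxCard P k = Σ (List V) λ S → IsMaximum P S × length S ≡ k

  HasUniqueMaximum : (List V → Set) → Set
  HasUniqueMaximum P = Σ (List V) (IsMaximum P)
                     × (∀ S T → IsMaximum P S → IsMaximum P T → SameSet S T)

Rho : ∀ {n} → SimpleGraph n → ℕ → Set
Rho G k = IsMaxCard (IsTwoPacking (Adj G)) k

RhoO' : ∀ {n} → SimpleGraph n → ℕ → Set
RhoO' G k = IsMaxCard (IsOpenPacking (Adj' G)) k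

module Submission where

-- A vertex set of G' either consists of original vertices only,
-- i.e. is the image  embed R  of a set R ⊆ V(G), or contains an edge vertex v_e.
--  * For R ⊆ V(G):  R is a 2-packing of G  iff  embed R is an open packing of G'
--    (two vertices at distance ≤ 2 in G share a neighbour in G', via a
--    common G-neighbour or via the edge vertex of the edge joining them).
--  * An open packing of G' containing v_e has no other member: by connectivity
--    every other vertex of G' shares a neighbour with v_e.  So it has size ≤ 1,
--    while every single vertex of G is a 2-packing.
-- Hence maximum 2-packings of G correspond to maximum open packings of G' of
-- the first kind, and a maximum open packing of the second kind only exists
-- when ρ(G) = 1, in which case both endpoints of e give distinct maximum
-- 2-packings.

open import Defs
open import Data.Nat using (_≤_; z≤n; s≤s)
open import Data.Nat.Properties using (≤-antisym; module ≤-Reasoning)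
open import Data.Fin using (Fin)
open import Data.Fin.Properties using (<-cmp)
open import Data.Bool using (T)
open import Data.List using (List; []; _∷_; [_]; map; length)
open import Data.List.Properties using (length-map)
open import Data.List.Membership.Propositional using (_∈_)
open import Data.List.Membership.Propositional.Properties using (∈-map⁺; ∈-map⁻)
open import Data.List.Relation.Unary.Any using (here; there)
open import Data.List.Relation.Unary.Any.Properties using (singleton⁻)
import Data.List.Relation.Unary.All as All
import Data.List.Relation.Unary.AllPairs as AllPairs
open All using (_∷_)
open AllPairs using (_∷_)
open import Data.List.Relation.Unary.Unique.Propositional using (Unique)
import Data.List.Relation.Unary.Unique.Propositional.Properties as Unique
import Data.List.Relation.Binary.Subset.Propositional.Properties as Subset
open import Data.Product using (Σ; _×_; _,_; proj₂)
open import Data.Sum using (_⊎_; inj₁; inj₂)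
open import Data.Sum.Properties using (inj₁-injective)
open import Data.Empty using (⊥; ⊥-elim)
open import Relation.Nullary using (¬_)
open import Relation.Binary using (tri<; tri≈; tri>)
open import Relation.Binary.PropositionalEquality using (_≡_; refl; sym; trans; cong; subst)
open import Function.Bundles using (_⇔_; mk⇔; Equivalence)

-- Refuting both P and ¬ P refutes anything.  This is the classical case split
-- used below on equality of edges: every such goal is ⊥, so no decision
-- procedure for edge equality is needed.
by-cases : {P : Set} → (P → ⊥) → (¬ P → ⊥) → ⊥
by-cases refute-P refute-¬P = refute-¬P refute-P

module _ {A : Set} where

  constant-unique-length≤1 : {a : A} (S : List A) → Unique S →
    (∀ {w} → w ∈ S → ¬ ¬ (w ≡ a)) → length S ≤ 1
  constant-unique-length≤1 [] _ _ = z≤n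
  constant-unique-length≤1 (x ∷ []) _ _ = s≤s z≤n
  constant-unique-length≤1 (x ∷ y ∷ S) ((x≢y ∷ _) ∷ _) all≡a =
    ⊥-elim (all≡a (here refl) λ x≡a → all≡a (there (here refl)) λ y≡a →
      x≢y (trans x≡a (sym y≡a)))

  member⇒nonempty : {x : A} {S : List A} → x ∈ S → 1 ≤ length S
  member⇒nonempty (here _) = s≤s z≤n
  member⇒nonempty (there _) = s≤s z≤n

module _ {A B : Set} where

  SameSet-map⁺ : (f : A → B) {xs ys : List A} →
    SameSet xs ys → SameSet (map f xs) (map f ys)
  SameSet-map⁺ f xs≈ys v =
    mk⇔ (Subset.map⁺ f (λ {x} → Equivalence.to (xs≈ys x)) {v})
        (Subset.map⁺ f (λ {x} → Equivalence.from (xs≈ys x)) {v})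

  SameSet-map⁻ : {f : A → B} → (∀ {x y} → f x ≡ f y → x ≡ y) →
    {xs ys : List A} → SameSet (map f xs) (map f ys) → SameSet xs ys
  SameSet-map⁻ {f} f-inj fxs≈fys x =
    mk⇔ (λ m → reflect (Equivalence.to (fxs≈fys (f x)) (∈-map⁺ f m)))
        (λ m → reflect (Equivalence.from (fxs≈fys (f x)) (∈-map⁺ f m)))
    where
    reflect : ∀ {zs} → f x ∈ map f zs → x ∈ zs
    reflect m with ∈-map⁻ f m
    ... | y , y∈zs , fx≡fy = subst (_∈ _) (sym (f-inj fx≡fy)) y∈zs

module _ {n} (G : SimpleGraph n) where

  TwoPacking : List (Fin n) → Set
  TwoPacking = IsTwoPacking (Adj G)

  OpenPacking' : List (Vtx' G) → Set
  OpenPacking' = IsOpenPacking (Adj' G)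

  EndOf : Fin n → Edge G → Set
  EndOf x e = Endpoint {G = G} x e

  NoCommonNeighbour : Vtx' G → Vtx' G → Set
  NoCommonNeighbour a b = ∀ x → Adj' G a x → Adj' G b x → ⊥

  adj-symmetric : ∀ {a b} → Adj G a b → Adj G b a
  adj-symmetric {a} {b} = subst T (adj-sym G a b)

  adj-irreflexive : ∀ {a} → ¬ Adj G a a
  adj-irreflexive {a} = subst T (adj-irr G a)

  edgeOf : ∀ {a b} → Adj G a b → Σ (Edge G) λ g → EndOf a g × EndOf b g
  edgeOf {a} {b} a~b with <-cmp a b
  ... | tri< a<b _ _ = ((a , b) , a<b , a~b) , inj₁ refl , inj₂ refl
  ... | tri≈ _ refl _ = ⊥-elim (adj-irreflexive a~b)
  ... | tri> _ _ b<a = ((b , a) , b<a , adj-symmetric a~b) , inj₂ refl , inj₁ refl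

  ends-adjacent : ∀ {a b} (g : Edge G) → EndOf a g → EndOf b g → ¬ a ≡ b → Adj G a b
  ends-adjacent _ (inj₁ refl) (inj₁ refl) a≢b = ⊥-elim (a≢b refl)
  ends-adjacent (_ , _ , p) (inj₁ refl) (inj₂ refl) _ = p
  ends-adjacent (_ , _ , p) (inj₂ refl) (inj₁ refl) _ = adj-symmetric p
  ends-adjacent _ (inj₂ refl) (inj₂ refl) a≢b = ⊥-elim (a≢b refl)

  -- An end x of e shares with v_e the other end of e as a neighbour.
  end-meets-edgeVertex : ∀ {x} (e : Edge G) → EndOf x e →
    ¬ NoCommonNeighbour (inj₂ e) (inj₁ x)
  end-meets-edgeVertex ((i , j) , _ , p) (inj₁ refl) apart = apart (inj₁ j) (inj₂ refl) p
  end-meets-edgeVertex ((i , j) , _ , p) (inj₂ refl) apart =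
    apart (inj₁ i) (inj₁ refl) (adj-symmetric p)

  -- A non-isolated vertex x meets every edge vertex v_e: if the edge g at x
  -- is e we are in the previous case, otherwise v_g is a common neighbour.
  nonisolated-meets-edgeVertex : ∀ {x y} (e : Edge G) → Adj G x y →
    ¬ NoCommonNeighbour (inj₂ e) (inj₁ x)
  nonisolated-meets-edgeVertex e x~y apart with edgeOf x~y
  ... | g , x∈g , _ = by-cases {g ≡ e}
    (λ { refl → end-meets-edgeVertex g x∈g apart })
    (λ g≢e → apart (inj₂ g) (λ e≡g → g≢e (sym e≡g)) x∈g)

  -- Two edge vertices v_e, v_f meet: walking in G from an end of e to an end
  -- of f, the first edge of the walk other than e is either f (and then its
  -- start is a common neighbour) or yields a common neighbour v_g.
  edgeVertices-meet : (e f : Edge G) → ∀ {u c} → EndOf u e → EndOf c f →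
    Reach G u c → ¬ NoCommonNeighbour (inj₂ e) (inj₂ f)
  edgeVertices-meet e f u∈e u∈f here apart = apart (inj₁ _) u∈e u∈f
  edgeVertices-meet e f {u} u∈e c∈f (step u~v walk) apart with edgeOf u~v
  ... | g , u∈g , v∈g = by-cases {g ≡ e}
    (λ { refl → edgeVertices-meet e f v∈g c∈f walk apart })
    (λ g≢e → by-cases {g ≡ f}
      (λ { refl → apart (inj₁ u) u∈e u∈g })
      (λ g≢f → apart (inj₂ g) (λ e≡g → g≢e (sym e≡g)) (λ f≡g → g≢f (sym f≡g))))

  -- In a connected graph, every vertex w of G' shares a neighbour with v_e:
  -- a vertex x of G either is the end i of e or has a neighbour (the first
  -- step of a walk from x to i).
  meets-edgeVertex : Connected G → (e : Edge G) (w : Vtx' G) →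
    ¬ NoCommonNeighbour (inj₂ e) w
  meets-edgeVertex conn e@((i , _) , _) (inj₁ x) with conn x i
  ... | here = end-meets-edgeVertex e (inj₁ refl)
  ... | step x~y _ = nonisolated-meets-edgeVertex e x~y
  meets-edgeVertex conn e@((i , _) , _) (inj₂ f@((c , _) , _)) =
    edgeVertices-meet e f (inj₁ refl) (inj₁ refl) (conn i c)

  edgeVertex-packing-small : Connected G → ∀ {S e} → Unique S → OpenPacking' S →
    inj₂ e ∈ S → length S ≤ 1
  edgeVertex-packing-small conn {S} {e} S-unique S-open e∈S =
    constant-unique-length≤1 S S-unique λ {w} w∈S w≢e →
      meets-edgeVertex conn e w (S-open e∈S w∈S (λ e≡w → w≢e (sym e≡w)))

  embed : List (Fin n) → List (Vtx' G)
  embed = map inj₁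

  length-embed : (R : List (Fin n)) → length (embed R) ≡ length R
  length-embed = length-map inj₁

  embed-unique : ∀ {R} → Unique R → Unique (embed R)
  embed-unique = Unique.map⁺ inj₁-injective

  data Shape : List (Vtx' G) → Set where
    withEdgeVertex : ∀ {S e} → inj₂ e ∈ S → Shape S
    embedded       : (R : List (Fin n)) → Shape (embed R)

  shape : (S : List (Vtx' G)) → Shape S
  shape [] = embedded []
  shape (inj₂ e ∷ S) = withEdgeVertex (here refl)
  shape (inj₁ x ∷ S) with shape S
  ... | withEdgeVertex e∈S = withEdgeVertex (there e∈S)
  ... | embedded R = embedded (x ∷ R)

  embed-openPacking : ∀ {R} → TwoPacking R → OpenPacking' (embed R)
  embed-openPacking R-packing a∈ b∈ a≢b z with ∈-map⁻ inj₁ a∈ | ∈-map⁻ inj₁ b∈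
  ... | a , a∈R , refl | b , b∈R , refl = common z
    where
    a≢b′ : ¬ a ≡ b
    a≢b′ a≡b = a≢b (cong inj₁ a≡b)
    apart : ∀ y → (y ≡ a) ⊎ Adj G a y → (y ≡ b) ⊎ Adj G b y → ⊥
    apart = R-packing a∈R b∈R a≢b′
    common : NoCommonNeighbour (inj₁ a) (inj₁ b)
    common (inj₁ y) a~y b~y = apart y (inj₂ a~y) (inj₂ b~y)
    common (inj₂ g) a∈g b∈g = apart b (inj₂ (ends-adjacent g a∈g b∈g a≢b′)) (inj₁ refl)

  embed-openPacking⁻ : ∀ {R} → OpenPacking' (embed R) → TwoPacking R
  embed-openPacking⁻ open' {a} {b} a∈R b∈R a≢b x = common
    where
    apart : NoCommonNeighbour (inj₁ a) (inj₁ b)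
    apart = open' (∈-map⁺ inj₁ a∈R) (∈-map⁺ inj₁ b∈R) (λ q → a≢b (inj₁-injective q))
    common : (x ≡ a) ⊎ Adj G a x → (x ≡ b) ⊎ Adj G b x → ⊥
    common (inj₁ refl) (inj₁ refl) = a≢b refl
    common (inj₁ refl) (inj₂ b~a) with edgeOf b~a
    ... | g , b∈g , a∈g = apart (inj₂ g) a∈g b∈g
    common (inj₂ a~b) (inj₁ refl) with edgeOf a~b
    ... | g , a∈g , b∈g = apart (inj₂ g) a∈g b∈g
    common (inj₂ a~x) (inj₂ b~x) = apart (inj₁ x) a~x b~x

  singleton-twoPacking : (x : Fin n) → TwoPacking [ x ]
  singleton-twoPacking x (here refl) (here refl) x≢x = ⊥-elim (x≢x refl)

  singleton-unique : (x : Fin n) → Unique [ x ]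
  singleton-unique x = All.[] ∷ AllPairs.[]

  maximum-embed⁻ : ∀ {R} → IsMaximum OpenPacking' (embed R) → IsMaximum TwoPacking R
  maximum-embed⁻ {R} (R-unique , R-open , R-max) =
    Unique.map⁻ R-unique , embed-openPacking⁻ R-open , λ R' R'-unique R'-packing →
      begin
        length R'          ≡⟨ sym (length-embed R') ⟩
        length (embed R')  ≤⟨ R-max _ (embed-unique R'-unique) (embed-openPacking R'-packing) ⟩
        length (embed R)   ≡⟨ length-embed R ⟩
        length R           ∎
    where open ≤-Reasoning

  maximum-embed : Connected G → ∀ {S} → IsMaximum TwoPacking S →
    IsMaximum OpenPacking' (embed S)
  maximum-embed conn {S} (S-unique , S-packing , S-max) =
    embed-unique S-unique , embed-openPacking S-packing , bound
    where
    open ≤-Reasoning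
    bound : ∀ T → Unique T → OpenPacking' T → length T ≤ length (embed S)
    bound T T-unique T-open with shape T
    ... | withEdgeVertex {e = ((i , _) , _)} e∈T = begin
      length T          ≤⟨ edgeVertex-packing-small conn T-unique T-open e∈T ⟩
      length [ i ]      ≤⟨ S-max [ i ] (singleton-unique i) (singleton-twoPacking i) ⟩
      length S          ≡⟨ sym (length-embed S) ⟩
      length (embed S)  ∎
    ... | embedded R = begin
      length (embed R)  ≡⟨ length-embed R ⟩
      length R          ≤⟨ S-max R (Unique.map⁻ T-unique) (embed-openPacking⁻ T-open) ⟩
      length S          ≡⟨ sym (length-embed S) ⟩
      length (embed S)  ∎

  end-maximum : Connected G → ∀ {T e x} → IsMaximum OpenPacking' T → inj₂ e ∈ T →
    EndOf x e → IsMaximum TwoPacking [ x ]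
  end-maximum conn {T} (T-unique , T-open , T-max) e∈T _ =
    singleton-unique _ , singleton-twoPacking _ , λ R R-unique R-packing →
      begin
        length R          ≡⟨ sym (length-embed R) ⟩
        length (embed R)  ≤⟨ T-max _ (embed-unique R-unique) (embed-openPacking R-packing) ⟩
        length T          ≤⟨ edgeVertex-packing-small conn T-unique T-open e∈T ⟩
        1                 ∎
    where open ≤-Reasoning

  -- Every maximum open packing of G' has the size of some maximum 2-packing
  -- of G: an end of its edge vertex, or the set it embeds.
  maximum-project : Connected G → ∀ {T} → IsMaximum OpenPacking' T →
    Σ (List (Fin n)) λ R → IsMaximum TwoPacking R × length R ≡ length T
  maximum-project conn {T} T-max@(T-unique , T-open , _) with shape T
  ... | withEdgeVertex {e = ((i , _) , _)} e∈T =
    [ i ] , end-maximum conn T-max e∈T (inj₁ refl) ,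
    ≤-antisym (member⇒nonempty e∈T) (edgeVertex-packing-small conn T-unique T-open e∈T)
  ... | embedded R = R , maximum-embed⁻ T-max , sym (length-embed R)

  -- Under uniqueness of the maximum 2-packing, no maximum open packing of G'
  -- contains an edge vertex v_e: both ends of e would be maximum 2-packings.
  unique⇒no-edgeVertex : Connected G → HasUniqueMaximum TwoPacking →
    ∀ {T e} → IsMaximum OpenPacking' T → inj₂ e ∈ T → ⊥
  unique⇒no-edgeVertex conn (_ , unique) {e = ((i , j) , _ , i~j)} T-max e∈T =
    adj-irreflexive (subst (Adj G i) (sym i≡j) i~j)
    where
    i≡j : i ≡ j
    i≡j = singleton⁻ (Equivalence.to
      (unique [ i ] [ j ] (end-maximum conn T-max e∈T (inj₁ refl))
                          (end-maximum conn T-max e∈T (inj₂ refl)) i)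
      (here refl))

  uniqueMaximum⇒ : Connected G → HasUniqueMaximum TwoPacking →
    HasUniqueMaximum OpenPacking'
  uniqueMaximum⇒ conn G-unique@((S , S-max) , _) =
    (embed S , maximum-embed conn S-max) , sameSet
    where
    sameSet : ∀ T₁ T₂ → IsMaximum OpenPacking' T₁ → IsMaximum OpenPacking' T₂ →
      SameSet T₁ T₂
    sameSet T₁ T₂ T₁-max T₂-max with shape T₁ | shape T₂
    ... | withEdgeVertex e∈T₁ | _ = ⊥-elim (unique⇒no-edgeVertex conn G-unique T₁-max e∈T₁)
    ... | embedded _ | withEdgeVertex e∈T₂ =
      ⊥-elim (unique⇒no-edgeVertex conn G-unique T₂-max e∈T₂)
    ... | embedded R₁ | embedded R₂ = SameSet-map⁺ inj₁
      (proj₂ G-unique R₁ R₂ (maximum-embed⁻ T₁-max) (maximum-embed⁻ T₂-max))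

  uniqueMaximum⇐ : Connected G → HasUniqueMaximum OpenPacking' →
    HasUniqueMaximum TwoPacking
  uniqueMaximum⇐ conn ((T , T-max) , unique) with maximum-project conn T-max
  ... | S , S-max , _ = (S , S-max) , λ S₁ S₂ S₁-max S₂-max →
    SameSet-map⁻ inj₁-injective
      (unique _ _ (maximum-embed conn S₁-max) (maximum-embed conn S₂-max))

mainTheorem6 : ∀ {n} (G : SimpleGraph n) → Connected G →
    (∀ k → Rho G k ⇔ RhoO' G k)
    × (HasUniqueMaximum (IsTwoPacking (Adj G)) ⇔ HasUniqueMaximum (IsOpenPacking (Adj' G)))
mainTheorem6 G conn = rho-equal , mk⇔ (uniqueMaximum⇒ G conn) (uniqueMaximum⇐ G conn)
  where
  rho-equal : ∀ k → Rho G k ⇔ RhoO' G k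
  rho-equal k = mk⇔
    (λ { (S , S-max , refl) → embed G S , maximum-embed G conn S-max , length-embed G S })
    (λ { (T , T-max , refl) → maximum-project G conn T-max })
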